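{- There are infinitely many primitive weak Carmichael numbers which are not prime powers.
   Context: A composite positive integer $n$ is called a weak Carmichael number if $\sum_{1\le k\le n-1,\ \gcd(k,n)=1} k^{n-1}\equiv \varphi(n)\pmod{n}$, where $\varphi$ is Euler's totient function. A weak Carmichael number $n$ is called a primitive weak Carmichael number if $n\ne m^f$ for every weak Carmichael number $m$ and every integer $f\ge 2$. -}

module Defs where

open import Data.Nat using (ℕ; zero; suc; _+_; _*_; _∸_; _^_; _≤_; _<_)
open import Data.Nat.GCD using (gcd)
open import Data.Nat.Primality using (Prime; Composite)
open import Data.Integer using (ℤ; +_; _-_)
open import Data.Integer.Divisibility using (_∣_)
open import Data.Product using (Σ; _×_; ∃; ∃-syntax)
open import Data.Nat using (_≟_)
open import Relation.Nullary using (¬_; yes; no)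
open import Relation.Binary.PropositionalEquality using (_≡_)

coprimeSumUpTo : (n : ℕ) → (ℕ → ℕ) → ℕ → ℕ
coprimeSumUpTo n f zero = 0
coprimeSumUpTo n f (suc m) with gcd (suc m) n ≟ 1
... | yes _ = f (suc m) + coprimeSumUpTo n f m
... | no  _ = coprimeSumUpTo n f m

φ : ℕ → ℕ
φ n = coprimeSumUpTo n (λ _ → 1) n

powerSum : ℕ → ℕ
powerSum n = coprimeSumUpTo n (λ k → k ^ (n ∸ 1)) (n ∸ 1)

_≡_[mod_] : ℕ → ℕ → ℕ → Set
a ≡ b [mod n ] = (+ n) ∣ ((+ a) - (+ b))

WeakCarmichael : ℕ → Set
WeakCarmichael n = Composite n × (powerSum n ≡ φ n [mod n ])

PrimitiveWeakCarmichael : ℕ → Set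
PrimitiveWeakCarmichael n =
  WeakCarmichael n ×
  (∀ (m f : ℕ) → 2 ≤ f → WeakCarmichael m → ¬ (n ≡ m ^ f))

IsPrimePower : ℕ → Set
IsPrimePower n = ∃[ p ] ∃[ e ] (Prime p × 1 ≤ e × n ≡ p ^ e)

-- The witnesses are n = 5·9^(c+1). Write S_m(n) for the sum of k^m over the units 1 ≤ k ≤ n
-- mod n, so that S_0(n) = φ(n). If d is odd and d ∣ n, the units mod nd are the k + nj
-- (j < d) with k a unit mod n, and by the binomial theorem Σ_{j<d} (k + nj)^m ≡ d·k^m
-- (mod dn), because d ∣ n makes n² ≡ 0 and Σ_{j<d} j = d(d-1)/2 is a multiple of d. Hence
-- S_m(nd) ≡ d·S_m(n) (mod dn) for every m, and S_m(n) ≡ φ(n) (mod n) passes from n to nd.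
-- It holds for n = 15 and all m ∈ 4ℕ since k^4 ≡ 1 (mod 15) for every unit k; multiplying
-- by 3 and then repeatedly by 9 reaches 5·9^(c+1) ≡ 1 (mod 4), for which n - 1 ∈ 4ℕ, so n is
-- a weak Carmichael number. As 3 and 5 divide n, it is not a prime power, and as 5 divides n
-- exactly once, it is not a perfect power at all.

module Submission where

open import Defs
open import Data.Nat using (ℕ; _<_)
open import Data.Product using (_×_; ∃-syntax)
open import Relation.Nullary using (¬_)

open import Data.Bool using (Bool; true; false; if_then_else_)
import Data.Bool as Bool
import Data.Integer as ℤ
import Data.Integer.Divisibility.Signed as ℤ∣
import Data.Integer.Properties as ℤP
import Data.Integer.Tactic.RingSolver as ℤSolver
open import Data.List using (upTo)
open import Data.List.Membership.Propositional.Properties using (∈-upTo⁺)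
import Data.List.Relation.Unary.All as All
open import Data.Nat using (zero; suc; _+_; _*_; _∸_; _^_; _≤_; _≟_; _%_; _/_; _<?_; s≤s; z≤n; NonZero)
open import Data.Nat.Coprimality using (Coprime; coprime-divisor; coprime⇒gcd≡1; gcd≡1⇒coprime)
open import Data.Nat.Divisibility
open import Data.Nat.DivMod using (m≡m%n+[m/n]*n)
open import Data.Nat.GCD using (gcd)
open import Data.Nat.Primality using (Prime; composite; prime?; prime⇒irreducible; euclidsLemma; ¬prime[1])
open import Data.Nat.Properties
open import Algebra.Properties.CommutativeSemigroup +-commutativeSemigroup
  using (interchange; x∙yz≈y∙xz)
open import Data.Nat.Tactic.RingSolver using (solve-∀)
open import Data.Product using (_,_; proj₁; proj₂)
open import Data.Sum using (inj₁; inj₂)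
open import Relation.Binary.PropositionalEquality
open import Relation.Nullary using (yes; no; Dec; contradiction)
open import Relation.Nullary.Decidable using (⌊_⌋; from-yes; from-no; _→-dec_)

sumIf : (ℕ → Bool) → (ℕ → ℕ) → ℕ → ℕ
sumIf P f zero    = 0
sumIf P f (suc m) = (if P (suc m) then f (suc m) else 0) + sumIf P f m

sumIf-cong : ∀ {P Q f g} m → (∀ k → P k ≡ Q k) → (∀ k → f k ≡ g k) →
             sumIf P f m ≡ sumIf Q g m
sumIf-cong zero    P≗Q f≗g = refl
sumIf-cong (suc m) P≗Q f≗g rewrite P≗Q (suc m) | f≗g (suc m) =
  cong (_ +_) (sumIf-cong m P≗Q f≗g)

sumIf-zero : ∀ P m → sumIf P (λ _ → 0) m ≡ 0
sumIf-zero P zero = refl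
sumIf-zero P (suc m) with P (suc m)
... | true  = sumIf-zero P m
... | false = sumIf-zero P m

sumIf-+ : ∀ P f a b →
          sumIf P f (a + b) ≡ sumIf P f a + sumIf (λ k → P (a + k)) (λ k → f (a + k)) b
sumIf-+ P f a zero    rewrite +-identityʳ a = sym (+-identityʳ _)
sumIf-+ P f a (suc b) rewrite +-suc a b | sumIf-+ P f a b =
  x∙yz≈y∙xz (if P (suc (a + b)) then f (suc (a + b)) else 0) (sumIf P f a) _

sumIf-+-distrib : ∀ P f g m → sumIf P (λ k → f k + g k) m ≡ sumIf P f m + sumIf P g m
sumIf-+-distrib P f g zero = refl
sumIf-+-distrib P f g (suc m) with P (suc m)
... | true  = trans (cong (_ +_) (sumIf-+-distrib P f g m))
                    (interchange (f (suc m)) (g (suc m)) (sumIf P f m) (sumIf P g m))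
... | false = sumIf-+-distrib P f g m

sumIf-congruence : ∀ P g h a d m →
                   (∀ k → k ≤ m → P k ≡ true → ∃[ Q ] g k ≡ a * h k + d * Q) →
                   ∃[ Q ] sumIf P g m ≡ a * sumIf P h m + d * Q
sumIf-congruence P g h a d zero _ = 0 , sym (cong₂ _+_ (*-zeroʳ a) (*-zeroʳ d))
sumIf-congruence P g h a d (suc m) termwise
  with sumIf-congruence P g h a d m (λ k k≤m → termwise k (m≤n⇒m≤1+n k≤m))
     | P (suc m) in Pk
... | Q , eq | false = Q , eq
... | Q , eq | true with termwise (suc m) ≤-refl Pk
... | Q′ , eq′ rewrite eq | eq′ = Q′ + Q , rearrange (h (suc m)) (sumIf P h m) a d Q′ Q
  where
  rearrange : ∀ x y a d q q′ → a * x + d * q + (a * y + d * q′) ≡ a * (x + y) + d * (q + q′)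
  rearrange = solve-∀

sumBelow : ℕ → (ℕ → ℕ) → ℕ
sumBelow zero    g = 0
sumBelow (suc d) g = sumBelow d g + g d

periodic-* : ∀ {A : Set} {P : ℕ → A} n → (∀ k → P (n + k) ≡ P k) →
             ∀ j k → P (n * j + k) ≡ P k
periodic-* n per zero    k rewrite *-zeroʳ n = refl
periodic-* {P = P} n per (suc j) k = begin
  P (n * suc j + k)    ≡⟨ cong (λ x → P (x + k)) (*-suc n j) ⟩
  P (n + n * j + k)    ≡⟨ cong P (+-assoc n (n * j) k) ⟩
  P (n + (n * j + k))  ≡⟨ per (n * j + k) ⟩
  P (n * j + k)        ≡⟨ periodic-* n per j k ⟩
  P k                  ∎
  where open ≡-Reasoning

sumIf-periodic : ∀ {P} n f d → (∀ k → P (n + k) ≡ P k) →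
                 sumIf P f (n * d) ≡ sumIf P (λ k → sumBelow d (λ j → f (n * j + k))) n
sumIf-periodic {P} n f zero    per rewrite *-zeroʳ n = sym (sumIf-zero P n)
sumIf-periodic {P} n f (suc d) per = begin
  sumIf P f (n * suc d)
    ≡⟨ cong (sumIf P f) (trans (*-suc n d) (+-comm n (n * d))) ⟩
  sumIf P f (n * d + n)
    ≡⟨ sumIf-+ P f (n * d) n ⟩
  sumIf P f (n * d) + sumIf (λ k → P (n * d + k)) (λ k → f (n * d + k)) n
    ≡⟨ cong₂ _+_ (sumIf-periodic n f d per) (sumIf-cong n (periodic-* n per d) (λ _ → refl)) ⟩
  sumIf P (λ k → sumBelow d (λ j → f (n * j + k))) n + sumIf P (λ k → f (n * d + k)) n
    ≡⟨ sym (sumIf-+-distrib P _ _ n) ⟩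
  sumIf P (λ k → sumBelow (suc d) (λ j → f (n * j + k))) n
    ∎
  where open ≡-Reasoning

binomial-mod-square : ∀ N j k m →
  ∃[ R ] (N * j + k) ^ suc m ≡ k ^ suc m + suc m * k ^ m * N * j + N * N * R
binomial-mod-square N j k zero = 0 , linear N j k
  where
  linear : ∀ N j k → (N * j + k) * 1 ≡ k * 1 + 1 * 1 * N * j + N * N * 0
  linear = solve-∀
binomial-mod-square N j k (suc m) with binomial-mod-square N j k m
... | R , eq = (1 + m) * k ^ m * j * j + (N * j + k) * R ,
               trans (cong ((N * j + k) *_) eq) (expand N j k (k ^ m) m R)
  where
  expand : ∀ N j k K m R →
    (N * j + k) * (k * K + (1 + m) * K * N * j + N * N * R)
    ≡ k * (k * K) + (2 + m) * (k * K) * N * j + N * N * ((1 + m) * K * j * j + (N * j + k) * R)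
  expand = solve-∀

sumBelow-binomial : ∀ N k m d → ∃[ R ]
  sumBelow d (λ j → (N * j + k) ^ suc m)
    ≡ d * k ^ suc m + suc m * k ^ m * N * sumBelow d (λ j → j) + N * N * R
sumBelow-binomial N k m zero = 0 , lemma (k ^ suc m) (suc m * k ^ m) N
  where
  lemma : ∀ X C N → 0 ≡ 0 * X + C * N * 0 + N * N * 0
  lemma = solve-∀
sumBelow-binomial N k m (suc d)
  with sumBelow-binomial N k m d | binomial-mod-square N d k m
... | R , eq | R′ , eq′ = R + R′ , trans (cong₂ _+_ eq eq′)
      (collect (k ^ suc m) (suc m * k ^ m) N d (sumBelow d (λ j → j)) R R′)
  where
  collect : ∀ X C N d T R R′ →
    d * X + C * N * T + N * N * R + (X + C * N * d + N * N * R′)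
    ≡ (1 + d) * X + C * N * (T + d) + N * N * (R + R′)
  collect = solve-∀

sumBelow-1 : ∀ d → sumBelow d (λ _ → 1) ≡ d
sumBelow-1 zero    = refl
sumBelow-1 (suc d) = trans (+-comm (sumBelow d (λ _ → 1)) 1) (cong suc (sumBelow-1 d))

2*sumBelow-id : ∀ d → 2 * sumBelow d (λ j → j) + d ≡ d * d
2*sumBelow-id zero    = refl
2*sumBelow-id (suc d) = begin
  2 * (T + d) + suc d  ≡⟨ step T d ⟩
  (2 * T + d) + 2 * d + 1  ≡⟨ cong (λ x → x + 2 * d + 1) (2*sumBelow-id d) ⟩
  d * d + 2 * d + 1   ≡⟨ square d ⟩
  suc d * suc d        ∎
  where
  open ≡-Reasoning
  T = sumBelow d (λ j → j)
  step : ∀ T d → 2 * (T + d) + (1 + d) ≡ (2 * T + d) + 2 * d + 1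
  step = solve-∀
  square : ∀ d → d * d + 2 * d + 1 ≡ (1 + d) * (1 + d)
  square = solve-∀

sumBelow-id-odd : ∀ e → sumBelow (suc (2 * e)) (λ j → j) ≡ suc (2 * e) * e
sumBelow-id-odd e = *-cancelˡ-≡ _ _ 2 (+-cancelʳ-≡ _ _ _ (begin
  2 * sumBelow d (λ j → j) + d  ≡⟨ 2*sumBelow-id d ⟩
  d * d                         ≡⟨ square e ⟩
  2 * (d * e) + d               ∎))
  where
  open ≡-Reasoning
  d = suc (2 * e)
  square : ∀ e → (1 + 2 * e) * (1 + 2 * e) ≡ 2 * ((1 + 2 * e) * e) + (1 + 2 * e)
  square = solve-∀

-- Modulo N², the sum is d·k^m + m·k^(m-1)·N·Σ_{j<d} j, and Σ_{j<d} j = d·e for d = 2e + 1.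
sumBelow-shiftedPowers : ∀ {d e N} → d ≡ suc (2 * e) → d ∣ N → ∀ m k →
  ∃[ Q ] sumBelow d (λ j → (N * j + k) ^ m) ≡ d * k ^ m + d * N * Q
sumBelow-shiftedPowers {d} {N = N} _ _ zero k =
  0 , trans (sumBelow-1 d)
            (sym (trans (cong₂ _+_ (*-identityʳ d) (*-zeroʳ (d * N))) (+-identityʳ d)))
sumBelow-shiftedPowers {e = e} {N} refl (divides q N≡q*d) (suc m) k
  with sumBelow-binomial N k m (suc (2 * e))
... | R , eq = C * e + q * R , (begin
  sumBelow d (λ j → (N * j + k) ^ suc m)
    ≡⟨ eq ⟩
  d * X + C * N * sumBelow d (λ j → j) + N * N * R
    ≡⟨ cong₂ (λ T M → d * X + C * N * T + N * M * R) (sumBelow-id-odd e) N≡q*d ⟩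
  d * X + C * N * (d * e) + N * (q * d) * R
    ≡⟨ regroup d X C N e q R ⟩
  d * X + d * N * (C * e + q * R)
    ∎)
  where
  open ≡-Reasoning
  d = suc (2 * e)
  X = k ^ suc m
  C = suc m * k ^ m
  regroup : ∀ d X C N e q R →
    d * X + C * N * (d * e) + N * (q * d) * R ≡ d * X + d * N * (C * e + q * R)
  regroup = solve-∀

isCoprimeTo : ℕ → ℕ → Bool
isCoprimeTo n k = ⌊ gcd k n ≟ 1 ⌋

coprimeSumUpTo≡sumIf : ∀ n f m → coprimeSumUpTo n f m ≡ sumIf (isCoprimeTo n) f m
coprimeSumUpTo≡sumIf n f zero = refl
coprimeSumUpTo≡sumIf n f (suc m) with gcd (suc m) n ≟ 1
... | yes _ = cong (f (suc m) +_) (coprimeSumUpTo≡sumIf n f m)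
... | no  _ = coprimeSumUpTo≡sumIf n f m

isCoprimeTo-cong : ∀ {k n l m} → (Coprime k n → Coprime l m) → (Coprime l m → Coprime k n) →
                   isCoprimeTo n k ≡ isCoprimeTo m l
isCoprimeTo-cong {k} {n} {l} {m} to from with gcd k n ≟ 1 | gcd l m ≟ 1
... | yes _ | yes _ = refl
... | no  _ | no  _ = refl
... | yes p | no ¬q = contradiction (coprime⇒gcd≡1 (to (gcd≡1⇒coprime p))) ¬q
... | no ¬p | yes q = contradiction (coprime⇒gcd≡1 (from (gcd≡1⇒coprime q))) ¬p

isCoprimeTo-+ : ∀ n k → isCoprimeTo n (n + k) ≡ isCoprimeTo n k
isCoprimeTo-+ n k = isCoprimeTo-cong to from
  where
  to : Coprime (n + k) n → Coprime k n
  to c (i∣k , i∣n) = c (∣m∣n⇒∣m+n i∣n i∣k , i∣n)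
  from : Coprime k n → Coprime (n + k) n
  from c (i∣n+k , i∣n) = c (∣m+n∣m⇒∣n i∣n+k i∣n , i∣n)

isCoprimeTo-* : ∀ {d n} k → d ∣ n → isCoprimeTo (n * d) k ≡ isCoprimeTo n k
isCoprimeTo-* {d} {n} k d∣n = isCoprimeTo-cong to from
  where
  to : Coprime k (n * d) → Coprime k n
  to c (i∣k , i∣n) = c (i∣k , ∣m⇒∣m*n d i∣n)
  from : Coprime k n → Coprime k (n * d)
  from c {i} (i∣k , i∣nd) = c (i∣k , ∣-trans i∣d d∣n)
    where
    i∣d : i ∣ d
    i∣d = coprime-divisor (λ (j∣i , j∣n) → c (∣-trans j∣i i∣k , j∣n)) i∣nd

coprimePowerSum : ℕ → ℕ → ℕ
coprimePowerSum m n = coprimeSumUpTo n (λ k → k ^ m) n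

coprimePowerSum-* : ∀ {d e n} → d ≡ suc (2 * e) → d ∣ n → ∀ m →
  ∃[ Q ] coprimePowerSum m (n * d) ≡ d * coprimePowerSum m n + d * n * Q
coprimePowerSum-* {d} {e} {n} odd d∣n m
  with sumIf-congruence (isCoprimeTo n) (λ k → sumBelow d (λ j → (n * j + k) ^ m))
         (λ k → k ^ m) d (d * n) n (λ k _ _ → sumBelow-shiftedPowers {e = e} odd d∣n m k)
... | Q , eq = Q , (begin
  coprimePowerSum m (n * d)
    ≡⟨ coprimeSumUpTo≡sumIf (n * d) f (n * d) ⟩
  sumIf (isCoprimeTo (n * d)) f (n * d)
    ≡⟨ sumIf-cong (n * d) (λ k → isCoprimeTo-* k d∣n) (λ _ → refl) ⟩
  sumIf (isCoprimeTo n) f (n * d)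
    ≡⟨ sumIf-periodic n f d (isCoprimeTo-+ n) ⟩
  sumIf (isCoprimeTo n) (λ k → sumBelow d (λ j → f (n * j + k))) n
    ≡⟨ eq ⟩
  d * sumIf (isCoprimeTo n) f n + d * n * Q
    ≡⟨ cong (λ s → d * s + d * n * Q) (sym (coprimeSumUpTo≡sumIf n f n)) ⟩
  d * coprimePowerSum m n + d * n * Q
    ∎)
  where
  open ≡-Reasoning
  f = λ k → k ^ m

-- Congruence on ℕ with a multiple of n on each side, so that no truncated subtraction occurs.
_≡_[modℕ_] : ℕ → ℕ → ℕ → Set
a ≡ b [modℕ n ] = ∃[ x ] ∃[ y ] a + x * n ≡ b + y * n

PowerSum≡φ : ℕ → ℕ → Set
PowerSum≡φ m n = coprimePowerSum m n ≡ φ n [modℕ n ]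

-- φ n is definitionally coprimePowerSum 0 n, so it scales like every other power sum.
PowerSum≡φ-* : ∀ {d e n m} → d ≡ suc (2 * e) → d ∣ n → PowerSum≡φ m n → PowerSum≡φ m (n * d)
PowerSum≡φ-* {d} {e} {n} {m} odd d∣n (x , y , S≡Φ)
  with coprimePowerSum-* {e = e} odd d∣n m | coprimePowerSum-* {e = e} odd d∣n 0
... | Q , S′ | Q′ , Φ′ = x + Q′ , y + Q , (begin
  coprimePowerSum m (n * d) + (x + Q′) * (n * d)
    ≡⟨ cong (_+ (x + Q′) * (n * d)) S′ ⟩
  d * S + d * n * Q + (x + Q′) * (n * d)
    ≡⟨ factor d n S x Q Q′ ⟩
  d * (S + x * n) + d * n * Q + d * n * Q′
    ≡⟨ cong (λ z → d * z + d * n * Q + d * n * Q′) S≡Φ ⟩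
  d * (Φ + y * n) + d * n * Q + d * n * Q′
    ≡⟨ unfactor d n Φ y Q Q′ ⟩
  d * Φ + d * n * Q′ + (y + Q) * (n * d)
    ≡⟨ cong (_+ (y + Q) * (n * d)) (sym Φ′) ⟩
  φ (n * d) + (y + Q) * (n * d)
    ∎)
  where
  open ≡-Reasoning
  S = coprimePowerSum m n
  Φ = φ n
  factor : ∀ d n S x Q Q′ →
    d * S + d * n * Q + (x + Q′) * (n * d) ≡ d * (S + x * n) + d * n * Q + d * n * Q′
  factor = solve-∀
  unfactor : ∀ d n Φ y Q Q′ →
    d * (Φ + y * n) + d * n * Q + d * n * Q′ ≡ d * Φ + d * n * Q′ + (y + Q) * (n * d)
  unfactor = solve-∀

[1+q*n]^t≡1+r*n : ∀ n q t → ∃[ r ] (1 + q * n) ^ t ≡ 1 + r * n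
[1+q*n]^t≡1+r*n n q zero    = 0 , refl
[1+q*n]^t≡1+r*n n q (suc t) with [1+q*n]^t≡1+r*n n q t
... | r , eq = q + r + q * r * n , trans (cong ((1 + q * n) *_) eq) (expand n q r)
  where
  expand : ∀ n q r → (1 + q * n) * (1 + r * n) ≡ 1 + (q + r + q * r * n) * n
  expand = solve-∀

k^e%n≡1⇒k^[e*t]≡1+n*r : ∀ n .{{_ : NonZero n}} k e t → k ^ e % n ≡ 1 → ∃[ r ] k ^ (e * t) ≡ 1 * 1 + n * r
k^e%n≡1⇒k^[e*t]≡1+n*r n k e t k^e≡1 with [1+q*n]^t≡1+r*n n (k ^ e / n) t
... | r , eq = r , (begin
  k ^ (e * t)                       ≡⟨ ^-*-assoc k e t ⟨
  (k ^ e) ^ t                       ≡⟨ cong (_^ t) (m≡m%n+[m/n]*n (k ^ e) n) ⟩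
  (k ^ e % n + k ^ e / n * n) ^ t   ≡⟨ cong (λ x → (x + k ^ e / n * n) ^ t) k^e≡1 ⟩
  (1 + k ^ e / n * n) ^ t           ≡⟨ eq ⟩
  1 + r * n                         ≡⟨ cong suc (*-comm r n) ⟩
  1 * 1 + n * r                     ∎)
  where open ≡-Reasoning

PowerSum≡φ-exponent : ∀ n e .{{_ : NonZero n}} →
  (∀ k → k ≤ n → isCoprimeTo n k ≡ true → k ^ e % n ≡ 1) → ∀ t → PowerSum≡φ (e * t) n
PowerSum≡φ-exponent n e units t
  with sumIf-congruence (isCoprimeTo n) (λ k → k ^ (e * t)) (λ _ → 1) 1 n n
         (λ k k≤n coprime → k^e%n≡1⇒k^[e*t]≡1+n*r n k e t (units k k≤n coprime))
... | Q , eq = 0 , Q , (begin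
  coprimePowerSum (e * t) n + 0 * n
    ≡⟨ +-identityʳ _ ⟩
  coprimePowerSum (e * t) n
    ≡⟨ coprimeSumUpTo≡sumIf n _ n ⟩
  sumIf (isCoprimeTo n) (λ k → k ^ (e * t)) n
    ≡⟨ eq ⟩
  1 * sumIf (isCoprimeTo n) (λ _ → 1) n + n * Q
    ≡⟨ cong₂ _+_ (trans (*-identityˡ _) (sym (coprimeSumUpTo≡sumIf n _ n))) (*-comm n Q) ⟩
  φ n + Q * n
    ∎)
  where open ≡-Reasoning

units-mod-15 : ∀ k → k ≤ 15 → isCoprimeTo 15 k ≡ true → k ^ 4 % 15 ≡ 1
units-mod-15 k k≤15 = All.lookup (from-yes (All.all? unit? (upTo 16))) (∈-upTo⁺ (s≤s k≤15))
  where
  unit? : ∀ k → Dec (isCoprimeTo 15 k ≡ true → k ^ 4 % 15 ≡ 1)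
  unit? k = isCoprimeTo 15 k Bool.≟ true →-dec k ^ 4 % 15 ≟ 1

coprimeSumUpTo-self : ∀ {n} → 1 < n → ∀ f → coprimeSumUpTo n f n ≡ coprimeSumUpTo n f (n ∸ 1)
coprimeSumUpTo-self {suc m} (s≤s 1≤m) f with gcd (suc m) (suc m) ≟ 1
... | no  _     = refl
... | yes gcd≡1 = contradiction (suc-injective n≡1) (≢-sym (<⇒≢ 1≤m))
  where
  n≡1 : suc m ≡ 1
  n≡1 = gcd≡1⇒coprime gcd≡1 (∣-refl , ∣-refl)

≡[modℕ]⇒≡[mod] : ∀ {a b n} → a ≡ b [modℕ n ] → a ≡ b [mod n ]
≡[modℕ]⇒≡[mod] {a} {b} {n} (x , y , eq) = ℤ∣.∣⇒∣ᵤ (ℤ∣.divides (+ y ℤ.- + x) (begin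
  + a ℤ.- + b
    ≡⟨ shift (+ a) (+ b) (+ x) (+ n) ⟩
  (+ a ℤ.+ + x ℤ.* + n) ℤ.- + x ℤ.* + n ℤ.- + b
    ≡⟨ cong (λ z → z ℤ.- + x ℤ.* + n ℤ.- + b) (trans (sym (lift a x)) (trans (cong +_ eq) (lift b y))) ⟩
  (+ b ℤ.+ + y ℤ.* + n) ℤ.- + x ℤ.* + n ℤ.- + b
    ≡⟨ cancel (+ b) (+ y) (+ x) (+ n) ⟩
  (+ y ℤ.- + x) ℤ.* + n
    ∎))
  where
  open ≡-Reasoning
  open ℤ using (+_)
  lift : ∀ u v → + (u + v * n) ≡ + u ℤ.+ + v ℤ.* + n
  lift u v = trans (ℤP.pos-+ u (v * n)) (cong (λ z → + u ℤ.+ z) (ℤP.pos-* v n))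
  shift : ∀ A B X N → A ℤ.- B ≡ (A ℤ.+ X ℤ.* N) ℤ.- X ℤ.* N ℤ.- B
  shift = ℤSolver.solve-∀
  cancel : ∀ B Y X N → (B ℤ.+ Y ℤ.* N) ℤ.- X ℤ.* N ℤ.- B ≡ (Y ℤ.- X) ℤ.* N
  cancel = ℤSolver.solve-∀

-- coprimePowerSum also runs over k = n, a term that is absent since gcd(n, n) = n ≠ 1.
PowerSum≡φ⇒powerSum≡φ : ∀ {n} → 1 < n → PowerSum≡φ (n ∸ 1) n → powerSum n ≡ φ n [mod n ]
PowerSum≡φ⇒powerSum≡φ {n} 1<n (x , y , eq) =
  ≡[modℕ]⇒≡[mod] (x , y , trans (cong (_+ x * n) (sym (coprimeSumUpTo-self 1<n _))) eq)

prime∣^⇒∣ : ∀ {p} a e → Prime p → p ∣ a ^ e → p ∣ a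
prime∣^⇒∣ a zero    pp p∣1 = contradiction (subst Prime (∣1⇒≡1 p∣1) pp) ¬prime[1]
prime∣^⇒∣ a (suc e) pp p∣a*aᵉ with euclidsLemma a (a ^ e) pp p∣a*aᵉ
... | inj₁ p∣a  = p∣a
... | inj₂ p∣aᵉ = prime∣^⇒∣ a e pp p∣aᵉ

prime∣prime^⇒≡ : ∀ {p q} e → Prime p → Prime q → p ∣ q ^ e → p ≡ q
prime∣prime^⇒≡ {q = q} e pp pq p∣qᵉ with prime⇒irreducible pq (prime∣^⇒∣ q e pp p∣qᵉ)
... | inj₁ p≡1 = contradiction (subst Prime p≡1 pp) ¬prime[1]
... | inj₂ p≡q = p≡q

two-primes⇒¬IsPrimePower : ∀ {p q n} → Prime p → Prime q → p ≢ q → p ∣ n → q ∣ n → ¬ IsPrimePower n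
two-primes⇒¬IsPrimePower {p} {q} pp pq p≢q p∣n q∣n (r , e , pr , _ , n≡rᵉ) =
  p≢q (trans (prime∣prime^⇒≡ e pp pr (subst (p ∣_) n≡rᵉ p∣n))
             (sym (prime∣prime^⇒≡ e pq pr (subst (q ∣_) n≡rᵉ q∣n))))

prime∥⇒≢^ : ∀ {p n} → Prime p → p ∣ n → ¬ p * p ∣ n → ∀ m f → 2 ≤ f → n ≢ m ^ f
prime∥⇒≢^ pp _ _ m 1 (s≤s ()) _
prime∥⇒≢^ {p} pp p∣n p²∤n m (suc (suc f)) _ n≡mᶠ =
  p²∤n (subst (p * p ∣_) (sym n≡mᶠ) (*-pres-∣ p∣m (∣m⇒∣m*n (m ^ f) p∣m)))
  where
  p∣m : p ∣ m
  p∣m = prime∣^⇒∣ m (suc (suc f)) pp (subst (p ∣_) n≡mᶠ p∣n)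

n<b^n : ∀ {b} → 1 < b → ∀ n → n < b ^ n
n<b^n 1<b zero    = s≤s z≤n
n<b^n {b} 1<b (suc n) = begin-strict
  suc n              <⟨ m<m+n (suc n) (≤-trans (s≤s z≤n) (n<b^n 1<b n)) ⟩
  suc n + b ^ n      ≤⟨ +-monoˡ-≤ (b ^ n) (n<b^n 1<b n) ⟩
  b ^ n + b ^ n      ≡⟨ cong (b ^ n +_) (+-identityʳ (b ^ n)) ⟨
  2 * b ^ n          ≤⟨ *-monoˡ-≤ (b ^ n) 1<b ⟩
  b * b ^ n          ∎
  where open ≤-Reasoning

prime3 : Prime 3
prime3 = from-yes (prime? 3)

prime5 : Prime 5
prime5 = from-yes (prime? 5)

witness : ℕ → ℕ
witness c = 5 * 9 ^ suc c

9∣witness : ∀ c → 9 ∣ witness c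
9∣witness c = ∣-trans (m∣m*n (9 ^ c)) (n∣m*n 5)

3∣witness : ∀ c → 3 ∣ witness c
3∣witness c = ∣-trans (divides 3 refl) (9∣witness c)

5∣witness : ∀ c → 5 ∣ witness c
5∣witness c = m∣m*n (9 ^ suc c)

25∤witness : ∀ c → ¬ 5 * 5 ∣ witness c
25∤witness c 25∣w = from-no (5 ∣? 9) (prime∣^⇒∣ 9 (suc c) prime5 (*-cancelˡ-∣ 5 25∣w))

9^1+c≤witness : ∀ c → 9 ^ suc c ≤ witness c
9^1+c≤witness c = m≤n*m (9 ^ suc c) 5

c<witness : ∀ c → c < witness c
c<witness c = <-≤-trans (n<b^n (s≤s (s≤s z≤n)) c) (≤-trans (^-monoʳ-≤ 9 (n≤1+n c)) (9^1+c≤witness c))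

3<witness : ∀ c → 3 < witness c
3<witness c = <-≤-trans (from-yes (3 <? 9)) (≤-trans (^-monoʳ-≤ 9 {1} {suc c} (s≤s z≤n)) (9^1+c≤witness c))

witness≡1+4* : ∀ c → ∃[ t ] witness c ≡ suc (4 * suc t)
witness≡1+4* c = 5 * r , trans (cong (5 *_) 9ᶜ≡1+4r) (expand r)
  where
  r : ℕ
  r = proj₁ ([1+q*n]^t≡1+r*n 4 2 (suc c))
  9ᶜ≡1+4r : 9 ^ suc c ≡ 1 + r * 4
  9ᶜ≡1+4r = proj₂ ([1+q*n]^t≡1+r*n 4 2 (suc c))
  expand : ∀ r → 5 * (1 + r * 4) ≡ suc (4 * suc (5 * r))
  expand = solve-∀

witness-PowerSum≡φ : ∀ c t → PowerSum≡φ (4 * t) (witness c)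
witness-PowerSum≡φ zero    t =
  PowerSum≡φ-* {e = 1} {m = 4 * t} refl (divides 5 refl) (PowerSum≡φ-exponent 15 4 units-mod-15 t)
witness-PowerSum≡φ (suc c) t =
  subst (PowerSum≡φ (4 * t)) (next (9 ^ c))
    (PowerSum≡φ-* {e = 4} {m = 4 * t} refl (9∣witness c) (witness-PowerSum≡φ c t))
  where
  next : ∀ X → 5 * (9 * X) * 9 ≡ 5 * (9 * (9 * X))
  next = solve-∀

PowerSum≡φ⇒powerSum≡φ-1+4* : ∀ {n} t → n ≡ suc (4 * suc t) →
                              PowerSum≡φ (4 * suc t) n → powerSum n ≡ φ n [mod n ]
PowerSum≡φ⇒powerSum≡φ-1+4* t refl = PowerSum≡φ⇒powerSum≡φ (s≤s (s≤s z≤n))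

-- Projections rather than a with on witness≡1+4* c: the with-abstraction exhausts memory here.
witness-WeakCarmichael : ∀ c → WeakCarmichael (witness c)
witness-WeakCarmichael c =
  composite (3<witness c) (3∣witness c) ,
  PowerSum≡φ⇒powerSum≡φ-1+4* t w≡1+4t (witness-PowerSum≡φ c (suc t))
  where
  t = proj₁ (witness≡1+4* c)
  w≡1+4t = proj₂ (witness≡1+4* c)

corollary2p28 : ∀ (N : ℕ) → ∃[ n ] (N < n × PrimitiveWeakCarmichael n × ¬ IsPrimePower n)
corollary2p28 N =
  witness N ,
  c<witness N ,
  (witness-WeakCarmichael N ,
   λ m f 2≤f _ → prime∥⇒≢^ prime5 (5∣witness N) (25∤witness N) m f 2≤f) ,
  two-primes⇒¬IsPrimePower prime3 prime5 (λ ()) (3∣witness N) (5∣witness N)
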